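{- If $P$ is a tree poset and $q$ is any positive integer, then $$M^*(n,q,P)\le\sum_{\mathrm{r}}\prod_{xy\in H(P)}n^{|\mathrm{r}(x)-\mathrm{r}(y)|}\cdot\binom{n}{\lfloor n/2\rfloor},$$ where the sum ranges over all poset homomorphisms $\mathrm{r}:P\to[q]$.
   Context: $\mathcal{B}_n$ is the power set of $[n]$. $M^*(n,q,P)$ is the number of induced copies of $P$ (images of injective maps $\varphi$ with $\varphi(x)\subsetneq\varphi(y)$ iff $x<_Py$) in the $q$ middle levels of $\mathcal{B}_n$, i.e. in the union of $q$ consecutive layers $\binom{[n]}{m},\dots,\binom{[n]}{m+q-1}$ chosen as central as possible; the levels are indexed $1,\dots,q$ from the top. A poset homomorphism $\mathrm{r}:P\to[q]$ satisfies $\mathrm{r}(x)<\mathrm{r}(y)$ in the target order whenever $x<_Py$, where $[q]$ carries the reverse of its natural order (so $x<_Py$ implies $\mathrm{r}(x)>\mathrm{r}(y)$ as integers). $H(P)$ is the Hasse diagram (pairs $xy$ with $x<y$ and nothing strictly between); $P$ is a tree poset if $H(P)$ as an undirected graph is a tree. -}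

module Defs where

open import Level using (0ℓ)
open import Data.Nat using (ℕ; zero; suc; _+_; _*_; _∸_; _^_; _≤_; _<_; ∣_-_∣; _/_)
import Data.Nat as ℕ
open import Data.Nat.Combinatorics using (_C_)
open import Data.Fin using (Fin; toℕ)
open import Data.Fin.Subset using (Subset; _⊂_; ∣_∣)
open import Data.Fin.Properties using (all?; any?)
open import Data.Vec using (Vec; []; _∷_; lookup)
open import Data.Nat.ListAction using (sum; product)
open import Data.List using (List; [_]; concatMap; map; filter; allFin; cartesianProduct; length)
open import Data.List.Relation.Unary.All using (All)
open import Data.List.Relation.Unary.AllPairs using (AllPairs)
open import Data.List.Relation.Unary.Unique.Propositional using (Unique)
open import Data.Product using (Σ; ∃; _×_; _,_; proj₁; proj₂)
open import Data.Sum using (_⊎_)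
open import Relation.Binary using (Rel; IsStrictPartialOrder; Decidable)
open import Relation.Binary.PropositionalEquality using (_≡_)
open import Relation.Nullary using (¬_; Dec)
open import Relation.Nullary.Decidable using (_×-dec_; _→-dec_; ¬?)
open import Function using (_⇔_; _∘_)
import Data.Nat.Properties as ℕP

record FinPoset : Set₁ where
  field
    size   : ℕ
    _<P_   : Rel (Fin size) 0ℓ
    isSPO  : IsStrictPartialOrder _≡_ _<P_
    _<P?_  : Decidable _<P_

module _ (P : FinPoset) where
  open FinPoset P

  Covers : Fin size → Fin size → Set
  Covers x y = (x <P y) × ¬ (∃ λ z → (x <P z) × (z <P y))

  covers? : Decidable Covers
  covers? x y = (x <P? y) ×-dec ¬? (any? (λ z → (x <P? z) ×-dec (z <P? y)))

  Adj : Fin size → Fin size → Set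
  Adj x y = Covers x y ⊎ Covers y x

  data Walk : Fin size → Fin size → Set where
    stop : ∀ x → Walk x x
    step : ∀ {x y z} → Adj x y → Walk y z → Walk x z

  Connected : Set
  Connected = ∀ x y → Walk x y

  data Chain : List (Fin size) → Set where
    chain1 : ∀ x → Chain [ x ]
    chain∷ : ∀ {x y vs} → Adj x y → Chain (y Data.List.∷ vs) → Chain (x Data.List.∷ y Data.List.∷ vs)

  Cycle : Set
  Cycle = Σ (Fin size) λ v₀ → Σ (List (Fin size)) λ rest →
            (2 ≤ length rest) ×
            Unique (v₀ Data.List.∷ rest) ×
            Chain (v₀ Data.List.∷ rest) ×
            Σ (Fin size) λ vₘ → (Data.List.last rest ≡ Data.Maybe.just vₘ) × Adj vₘ v₀
    where import Data.Maybe

  IsTreePoset : Set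
  IsTreePoset = (1 ≤ size) × Connected × ¬ Cycle

  -- Poset homomorphisms r : P → [q] where [q] carries the reverse order:
  -- x < y in P implies r(x) > r(y) as integers.  [q] = {1..q} is encoded
  -- as Fin q (shift by one, irrelevant for differences / order).
  IsHom : (q : ℕ) → (Fin size → Fin q) → Set
  IsHom q r = ∀ x y → x <P y → toℕ (r y) < toℕ (r x)

  isHom? : (q : ℕ) → (r : Fin size → Fin q) → Dec (IsHom q r)
  isHom? q r = all? λ x → all? λ y → (x <P? y) →-dec (toℕ (r y) ℕP.<? toℕ (r x))

  hasseEdges : List (Fin size × Fin size)
  hasseEdges = filter (λ e → covers? (proj₁ e) (proj₂ e)) (cartesianProduct (allFin size) (allFin size))

allVecs : (k q : ℕ) → List (Vec (Fin q) k)
allVecs zero    q = [ [] ]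
allVecs (suc k) q = concatMap (λ v → map (Data.Vec._∷ v) (allFin q)) (allVecs k q)

module _ (P : FinPoset) where
  open FinPoset P

  homs : (q : ℕ) → List (Fin size → Fin q)
  homs q = filter (isHom? P q) (map lookup (allVecs size q))

  bound : (n q : ℕ) → ℕ
  bound n q = sum (map (λ r → product (map (λ e → n ^ ∣ toℕ (r (proj₁ e)) - toℕ (r (proj₂ e)) ∣) (hasseEdges P))) (homs q))
              * (n C (n / 2))

-- The q middle levels of B_n: layers m, …, m+q-1 with m = ⌊(n+1-q)/2⌋
-- (truncated subtraction: if q ≥ n+1 this is all of B_n).

middleStart : (n q : ℕ) → ℕ
middleStart n q = (suc n ∸ q) / 2

InMiddle : (n q : ℕ) → Subset n → Set
InMiddle n q A = (middleStart n q ≤ ∣ A ∣) × (∣ A ∣ < middleStart n q + q)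

module _ (P : FinPoset) where
  open FinPoset P

  IsInducedCopy : (n q : ℕ) → (Fin size → Subset n) → Set
  IsInducedCopy n q φ =
    (∀ x y → φ x ≡ φ y → x ≡ y) ×
    (∀ x y → (x <P y) ⇔ (φ x ⊂ φ y)) ×
    (∀ x → InMiddle n q (φ x))

SameImage : ∀ {k n} → (Fin k → Subset n) → (Fin k → Subset n) → Set
SameImage φ ψ = (∀ x → ∃ λ y → φ x ≡ ψ y) × (∀ y → ∃ λ x → ψ y ≡ φ x)

-- Encode a map φ : P → Bₙ by φ(root) together with, for every Hasse edge x ⋖ y, the list of
-- elements of φ(y) ∖ φ(x).  Since H(P) is connected, φ is rebuilt from its code by walking out
-- from the root, so distinct maps have distinct codes; connectedness is all that is used of the
-- tree hypothesis.  Counting levels from the top, x ↦ level of φ(x) is a homomorphism r : P → [q].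
-- For fixed r the root set is one of at most C(n, ⌊n/2⌋) sets of its size, and the word on an edge
-- xy has length |r(x) − r(y)|, so is one of n^|r(x) − r(y)| words.  Hence the codes of all strictly
-- monotone maps into q consecutive levels are at most as many as the bound.

module Submission where

open import Defs
open import Data.Nat
  using (ℕ; zero; suc; _+_; _*_; _∸_; _^_; _≤_; _<_; _≤′_; ≤′-refl; ≤′-step; z≤n; s≤s; s≤s⁻¹; ∣_-_∣; _/_; _%_)
open import Data.Nat.Properties
open import Data.Nat.Combinatorics using (_C_; nCk+nC[k+1]≡[n+1]C[k+1]; nC1≡n; nCk≡nC[n∸k]; k>n⇒nCk≡0)
open import Data.Nat.DivMod using (m≡m%n+[m/n]*n; m%n<n)
open import Data.Nat.ListAction using (sum; product)
open import Data.Nat.Tactic.RingSolver using (solve-∀)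
open import Data.Fin using (Fin; zero; suc; toℕ; fromℕ<)
import Data.Fin as Fin
open import Data.Fin.Properties using (toℕ-fromℕ<)
import Data.Fin.Properties as Fin
open import Data.Fin.Subset using (Subset; inside; outside; ∣_∣; _⊆_; _⊂_)
open import Data.Fin.Subset.Properties using (drop-∷-⊆; p⊂q⇒∣p∣<∣q∣)
open import Data.Vec using (Vec; []; _∷_; here; lookup; tabulate)
open import Data.Vec.Properties using (lookup∘tabulate)
open import Data.List
  using (List; []; _∷_; [_]; _++_; length; map; concatMap; allFin; cartesianProductWith; cartesianProduct)
open import Data.List.Properties
  using (length-map; length-++; length-tabulate; length-removeAt′; ∷-injective; map-injective; map-∘; map-cong)
open import Data.List.Membership.Propositional using (_∈_; _─_; lose)
open import Data.List.Membership.Propositional.Properties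
  using (∈-++⁺ˡ; ∈-++⁺ʳ; ∈-map⁺; ∈-allFin; ∈-concatMap⁺; ∈-cartesianProductWith⁺; ∈-cartesianProduct⁺; ∈-filter⁺; ∈-filter⁻)
open import Data.List.Relation.Unary.All using (All; []; _∷_)
import Data.List.Relation.Unary.All as All
import Data.List.Relation.Unary.All.Properties as All
open import Data.List.Relation.Unary.Any using (here; there; index)
open import Data.List.Relation.Unary.AllPairs using (AllPairs; []; _∷_)
import Data.List.Relation.Unary.AllPairs as AllPairs
open import Data.List.Relation.Unary.Unique.Propositional using (Unique)
open import Data.Product using (_×_; _,_; proj₁; proj₂; uncurry)
open import Data.Sum using (inj₁; inj₂)
open import Function using (_∘_; Equivalence)
open import Relation.Binary.PropositionalEquality
  using (_≡_; _≢_; _≗_; refl; sym; trans; cong; cong₂; subst; subst₂; module ≡-Reasoning)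
open import Relation.Nullary using (¬_; yes; no; contradiction)

private variable
  A B : Set

∣[m∸n]-[m∸o]∣≡∣n-o∣ : ∀ {m n o} → n ≤ m → o ≤ m → ∣ (m ∸ n) - (m ∸ o) ∣ ≡ ∣ n - o ∣
∣[m∸n]-[m∸o]∣≡∣n-o∣ {m}     z≤n       z≤n       = ∣n-n∣≡0 m
∣[m∸n]-[m∸o]∣≡∣n-o∣ {suc m} {o = suc o} z≤n (s≤s o≤m) =
  trans (m≤n⇒∣n-m∣≡n∸m (m≤n⇒m≤1+n (m∸n≤m m o))) (m∸[m∸n]≡n (s≤s o≤m))
∣[m∸n]-[m∸o]∣≡∣n-o∣ {suc m} {suc n} (s≤s n≤m) z≤n =
  trans (m≤n⇒∣m-n∣≡n∸m (m≤n⇒m≤1+n (m∸n≤m m n))) (m∸[m∸n]≡n (s≤s n≤m))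
∣[m∸n]-[m∸o]∣≡∣n-o∣         (s≤s n≤m) (s≤s o≤m) = ∣[m∸n]-[m∸o]∣≡∣n-o∣ n≤m o≤m

[1+k]*nC[1+k]+k*nCk≡n*nCk : ∀ n k → suc k * (n C suc k) + k * (n C k) ≡ n * (n C k)
[1+k]*nC[1+k]+k*nCk≡n*nCk zero    zero    = refl
[1+k]*nC[1+k]+k*nCk≡n*nCk zero    (suc k) = cong₂ _+_ (*-zeroʳ (2 + k)) (*-zeroʳ (suc k))
[1+k]*nC[1+k]+k*nCk≡n*nCk (suc n) zero    =
  trans (+-identityʳ _) (trans (*-identityˡ _) (trans (nC1≡n (suc n)) (sym (*-identityʳ (suc n)))))
[1+k]*nC[1+k]+k*nCk≡n*nCk (suc n) (suc k)
  rewrite sym (nCk+nC[k+1]≡[n+1]C[k+1] n k) | sym (nCk+nC[k+1]≡[n+1]C[k+1] n (suc k)) = begin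
    (2 + k) * (a + b) + (1 + k) * (c + a)
      ≡⟨ regroup k a b c ⟩
    ((2 + k) * b + (1 + k) * a) + ((1 + k) * a + k * c) + (a + c)
      ≡⟨ cong₂ (λ u v → u + v + (a + c)) ([1+k]*nC[1+k]+k*nCk≡n*nCk n (suc k)) ([1+k]*nC[1+k]+k*nCk≡n*nCk n k) ⟩
    n * a + n * c + (a + c)
      ≡⟨ collect n a c ⟩
    suc n * (c + a) ∎
  where
  open ≡-Reasoning
  a = n C suc k
  b = n C suc (suc k)
  c = n C k
  regroup : ∀ k a b c → (2 + k) * (a + b) + (1 + k) * (c + a) ≡ ((2 + k) * b + (1 + k) * a) + ((1 + k) * a + k * c) + (a + c)
  regroup = solve-∀
  collect : ∀ n a c → n * a + n * c + (a + c) ≡ suc n * (c + a)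
  collect = solve-∀

nCk≤nC[1+k] : ∀ {n k} → suc (k + k) ≤ n → n C k ≤ n C suc k
nCk≤nC[1+k] {n} {k} 2k<n = *-cancelˡ-≤ (suc k) (+-cancelʳ-≤ (k * (n C k)) _ _ (begin
  suc k * (n C k) + k * (n C k)       ≡⟨ *-distribʳ-+ (n C k) (suc k) k ⟨
  suc (k + k) * (n C k)               ≤⟨ *-monoˡ-≤ (n C k) 2k<n ⟩
  n * (n C k)                         ≡⟨ [1+k]*nC[1+k]+k*nCk≡n*nCk n k ⟨
  suc k * (n C suc k) + k * (n C k)   ∎))
  where open ≤-Reasoning

nCi≤nCj : ∀ {n i j} → i ≤′ j → j + j ≤ n → n C i ≤ n C j
nCi≤nCj ≤′-refl _ = ≤-refl
nCi≤nCj {j = suc j} (≤′-step i≤′j) 2[1+j]≤n = ≤-trans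
  (nCi≤nCj i≤′j (≤-trans (+-mono-≤ (n≤1+n j) (n≤1+n j)) 2[1+j]≤n))
  (nCk≤nC[1+k] (≤-trans (s≤s (+-monoʳ-≤ j (n≤1+n j))) 2[1+j]≤n))

n≡n%2+[[n/2]+[n/2]] : ∀ n → n ≡ n % 2 + (n / 2 + n / 2)
n≡n%2+[[n/2]+[n/2]] n = trans (m≡m%n+[m/n]*n n 2)
  (cong (n % 2 +_) (trans (*-comm (n / 2) 2) (cong (n / 2 +_) (+-identityʳ (n / 2)))))

[n/2]+[n/2]≤n : ∀ n → n / 2 + n / 2 ≤ n
[n/2]+[n/2]≤n n = ≤-trans (m≤n+m _ (n % 2)) (≤-reflexive (sym (n≡n%2+[[n/2]+[n/2]] n)))

n≤1+[n/2]+[n/2] : ∀ n → n ≤ suc (n / 2 + n / 2)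
n≤1+[n/2]+[n/2] n = ≤-trans (≤-reflexive (n≡n%2+[[n/2]+[n/2]] n)) (+-monoˡ-≤ _ (s≤s⁻¹ (m%n<n n 2)))

nCk≤nC[n/2] : ∀ n k → n C k ≤ n C (n / 2)
nCk≤nC[n/2] n k with k ≤? n / 2 | k ≤? n
... | yes k≤n/2 | _       = nCi≤nCj (≤⇒≤′ k≤n/2) ([n/2]+[n/2]≤n n)
... | no  k≰n/2 | yes k≤n = begin
  n C k       ≡⟨ nCk≡nC[n∸k] k≤n ⟩
  n C (n ∸ k) ≤⟨ nCi≤nCj (≤⇒≤′ n∸k≤n/2) ([n/2]+[n/2]≤n n) ⟩
  n C (n / 2) ∎
  where
  open ≤-Reasoning
  n∸k≤n/2 : n ∸ k ≤ n / 2
  n∸k≤n/2 = ≤-trans (∸-monoʳ-≤ n (≰⇒> k≰n/2)) (m≤n+o⇒m∸n≤o n (suc (n / 2)) (n≤1+[n/2]+[n/2] n))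
... | no  _     | no  k≰n = ≤-trans (≤-reflexive (k>n⇒nCk≡0 (≰⇒> k≰n))) z≤n

length-cartesianProductWith : ∀ {C : Set} (f : A → B → C) xs ys →
  length (cartesianProductWith f xs ys) ≡ length xs * length ys
length-cartesianProductWith f []       ys = refl
length-cartesianProductWith f (x ∷ xs) ys = begin
  length (map (f x) ys ++ cartesianProductWith f xs ys)
    ≡⟨ length-++ (map (f x) ys) ⟩
  length (map (f x) ys) + length (cartesianProductWith f xs ys)
    ≡⟨ cong₂ _+_ (length-map (f x) ys) (length-cartesianProductWith f xs ys) ⟩
  length ys + length xs * length ys ∎
  where open ≡-Reasoning

length-concatMap-≤ : ∀ (f : A → List B) (g : A → ℕ) c → (∀ x → length (f x) ≤ g x * c) →
  ∀ xs → length (concatMap f xs) ≤ sum (map g xs) * c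
length-concatMap-≤ f g c bound []       = z≤n
length-concatMap-≤ f g c bound (x ∷ xs) = begin
  length (f x ++ concatMap f xs)          ≡⟨ length-++ (f x) ⟩
  length (f x) + length (concatMap f xs)  ≤⟨ +-mono-≤ (bound x) (length-concatMap-≤ f g c bound xs) ⟩
  g x * c + sum (map g xs) * c            ≡⟨ *-distribʳ-+ c (g x) (sum (map g xs)) ⟨
  sum (map g (x ∷ xs)) * c                ∎
  where open ≤-Reasoning

∈-─ : ∀ {x y : A} {ys} (x∈ys : x ∈ ys) → y ∈ ys → y ≢ x → y ∈ ys ─ x∈ys
∈-─ (here refl) (here refl) y≢x = contradiction refl y≢x
∈-─ (here _)    (there y∈ys) _  = y∈ys
∈-─ (there _)   (here refl)  _  = here refl
∈-─ (there x∈ys) (there y∈ys) y≢x = there (∈-─ x∈ys y∈ys y≢x)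

Unique⇒length-≤ : ∀ {xs ys : List A} → Unique xs → All (_∈ ys) xs → length xs ≤ length ys
Unique⇒length-≤ []              []               = z≤n
Unique⇒length-≤ {xs = _ ∷ xs} {ys} (x≢xs ∷ !xs) (x∈ys ∷ xs⊆ys) = begin
  suc (length xs)                    ≤⟨ s≤s (Unique⇒length-≤ !xs xs⊆ys─x) ⟩
  suc (length (ys ─ x∈ys))           ≡⟨ length-removeAt′ ys (index x∈ys) ⟨
  length ys                          ∎
  where
  open ≤-Reasoning
  xs⊆ys─x = All.zipWith (uncurry λ y∈ys x≢y → ∈-─ x∈ys y∈ys (x≢y ∘ sym)) (xs⊆ys , x≢xs)

choices : List (List A) → List (List A)
choices []         = [ [] ]
choices (xs ∷ xss) = cartesianProductWith _∷_ xs (choices xss)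

length-choices : (xss : List (List A)) → length (choices xss) ≡ product (map length xss)
length-choices []         = refl
length-choices (xs ∷ xss) =
  trans (length-cartesianProductWith _∷_ xs (choices xss)) (cong (length xs *_) (length-choices xss))

∈-choices⁺ : ∀ {I : Set} {f : I → A} {g : I → List A} {is} →
             All (λ i → f i ∈ g i) is → map f is ∈ choices (map g is)
∈-choices⁺ []           = here refl
∈-choices⁺ (fi∈gi ∷ fis∈gis) = ∈-cartesianProductWith⁺ _∷_ fi∈gi (∈-choices⁺ fis∈gis)

words : (n d : ℕ) → List (List (Fin n))
words n zero    = [ [] ]
words n (suc d) = cartesianProductWith _∷_ (allFin n) (words n d)

length-words : ∀ n d → length (words n d) ≡ n ^ d
length-words n zero    = refl
length-words n (suc d) = trans (length-cartesianProductWith _∷_ (allFin n) (words n d))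
  (cong₂ _*_ (length-tabulate {n = n} (λ i → i)) (length-words n d))

∈-words : ∀ {n} (w : List (Fin n)) → w ∈ words n (length w)
∈-words []      = here refl
∈-words (i ∷ w) = ∈-cartesianProductWith⁺ _∷_ (∈-allFin i) (∈-words w)

subsetsOfSize : (n k : ℕ) → List (Subset n)
subsetsOfSize zero    zero    = [ [] ]
subsetsOfSize zero    (suc k) = []
subsetsOfSize (suc n) zero    = map (outside ∷_) (subsetsOfSize n zero)
subsetsOfSize (suc n) (suc k) = map (inside ∷_) (subsetsOfSize n k) ++ map (outside ∷_) (subsetsOfSize n (suc k))

length-subsetsOfSize : ∀ n k → length (subsetsOfSize n k) ≡ n C k
length-subsetsOfSize zero    zero    = refl
length-subsetsOfSize zero    (suc k) = refl
length-subsetsOfSize (suc n) zero    = trans (length-map _ (subsetsOfSize n zero)) (length-subsetsOfSize n zero)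
length-subsetsOfSize (suc n) (suc k) = begin
  length (map (inside ∷_) (subsetsOfSize n k) ++ map (outside ∷_) (subsetsOfSize n (suc k)))
    ≡⟨ length-++ (map (inside ∷_) (subsetsOfSize n k)) ⟩
  length (map (inside ∷_) (subsetsOfSize n k)) + length (map (outside ∷_) (subsetsOfSize n (suc k)))
    ≡⟨ cong₂ _+_ (length-map _ (subsetsOfSize n k)) (length-map _ (subsetsOfSize n (suc k))) ⟩
  length (subsetsOfSize n k) + length (subsetsOfSize n (suc k))
    ≡⟨ cong₂ _+_ (length-subsetsOfSize n k) (length-subsetsOfSize n (suc k)) ⟩
  n C k + n C suc k
    ≡⟨ nCk+nC[k+1]≡[n+1]C[k+1] n k ⟩
  suc n C suc k ∎
  where open ≡-Reasoning

∈-subsetsOfSize : ∀ {n k} (p : Subset n) → ∣ p ∣ ≡ k → p ∈ subsetsOfSize n k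
∈-subsetsOfSize {k = zero}  []            _  = here refl
∈-subsetsOfSize {k = suc k} (inside  ∷ p) eq = ∈-++⁺ˡ (∈-map⁺ (inside ∷_) (∈-subsetsOfSize p (suc-injective eq)))
∈-subsetsOfSize {k = zero}  (outside ∷ p) eq = ∈-map⁺ (outside ∷_) (∈-subsetsOfSize p eq)
∈-subsetsOfSize {suc n} {suc k} (outside ∷ p) eq =
  ∈-++⁺ʳ (map (inside ∷_) (subsetsOfSize n k)) (∈-map⁺ (outside ∷_) (∈-subsetsOfSize p eq))

∈-allVecs : ∀ {k q} (v : Vec (Fin q) k) → v ∈ allVecs k q
∈-allVecs []      = here refl
∈-allVecs (i ∷ v) = ∈-concatMap⁺ _ (lose (∈-allVecs v) (∈-map⁺ (_∷ v) (∈-allFin i)))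

map-≡⇒≡ : ∀ {f g : A → B} {xs x} → map f xs ≡ map g xs → x ∈ xs → f x ≡ g x
map-≡⇒≡ {xs = _ ∷ _} eq (here refl) = proj₁ (∷-injective eq)
map-≡⇒≡ {xs = _ ∷ _} eq (there x∈xs) = map-≡⇒≡ (proj₂ (∷-injective eq)) x∈xs

Unique-map⁺ : ∀ {P : A → Set} {_≈_ : A → A → Set} {f : A → B} {xs} →
  (∀ {x y} → P x → P y → f x ≡ f y → x ≈ y) →
  All P xs → AllPairs (λ x y → ¬ x ≈ y) xs → Unique (map f xs)
Unique-map⁺ inj []         []                 = []
Unique-map⁺ inj (px ∷ pxs) (x≉xs ∷ distinct) =
  All.map⁺ (All.zipWith (uncurry λ py x≉y → x≉y ∘ inj px py) (pxs , x≉xs)) ∷ Unique-map⁺ inj pxs distinct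

-- lists the elements of q ─ p
listDiff : ∀ {n} → Subset n → Subset n → List (Fin n)
listDiff []            []            = []
listDiff (inside  ∷ q) (outside ∷ p) = zero ∷ map suc (listDiff q p)
listDiff (inside  ∷ q) (inside  ∷ p) = map suc (listDiff q p)
listDiff (outside ∷ q) (_       ∷ p) = map suc (listDiff q p)

length-listDiff : ∀ {n} {p q : Subset n} → p ⊆ q → ∣ p ∣ + length (listDiff q p) ≡ ∣ q ∣
length-listDiff {p = []}    {[]}    _     = refl
length-listDiff {p = x ∷ p} {y ∷ q} xp⊆yq =
  extend x y xp⊆yq (trans (cong (∣ p ∣ +_) (length-map Fin.suc (listDiff q p))) (length-listDiff (drop-∷-⊆ xp⊆yq)))
  where
  extend : ∀ x y → x ∷ p ⊆ y ∷ q → ∣ p ∣ + length (map suc (listDiff q p)) ≡ ∣ q ∣ →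
           ∣ x ∷ p ∣ + length (listDiff (y ∷ q) (x ∷ p)) ≡ ∣ y ∷ q ∣
  extend outside inside  _     eq = trans (+-suc ∣ p ∣ _) (cong suc eq)
  extend inside  inside  _     eq = cong suc eq
  extend outside outside _     eq = eq
  extend inside  outside xp⊆yq _  = contradiction (xp⊆yq here) λ ()

zero∷≢map-suc : ∀ {n} {is : List (Fin (suc n))} {js : List (Fin n)} → zero ∷ is ≢ map suc js
zero∷≢map-suc {js = []}    ()
zero∷≢map-suc {js = _ ∷ _} ()

map-suc-injective : ∀ {n} {is js : List (Fin n)} → map suc is ≡ map suc js → is ≡ js
map-suc-injective = map-injective Fin.suc-injective

listDiff-injectiveˡ : ∀ {n} {p q q′ : Subset n} → p ⊆ q → p ⊆ q′ → listDiff q p ≡ listDiff q′ p → q ≡ q′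
listDiff-injectiveˡ {p = []} {[]} {[]} _ _ _ = refl
listDiff-injectiveˡ {p = inside ∷ p} {outside ∷ q} p⊆q _ _ = contradiction (p⊆q here) λ ()
listDiff-injectiveˡ {p = inside ∷ p} {_} {outside ∷ q′} _ p⊆q′ _ = contradiction (p⊆q′ here) λ ()
listDiff-injectiveˡ {p = inside ∷ p} {inside ∷ q} {inside ∷ q′} p⊆q p⊆q′ eq =
  cong (inside ∷_) (listDiff-injectiveˡ (drop-∷-⊆ p⊆q) (drop-∷-⊆ p⊆q′) (map-suc-injective eq))
listDiff-injectiveˡ {p = outside ∷ p} {inside ∷ q} {inside ∷ q′} p⊆q p⊆q′ eq =
  cong (inside ∷_) (listDiff-injectiveˡ (drop-∷-⊆ p⊆q) (drop-∷-⊆ p⊆q′) (map-suc-injective (proj₂ (∷-injective eq))))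
listDiff-injectiveˡ {p = outside ∷ p} {outside ∷ q} {outside ∷ q′} p⊆q p⊆q′ eq =
  cong (outside ∷_) (listDiff-injectiveˡ (drop-∷-⊆ p⊆q) (drop-∷-⊆ p⊆q′) (map-suc-injective eq))
listDiff-injectiveˡ {p = outside ∷ p} {inside ∷ q} {outside ∷ q′} _ _ eq = contradiction eq zero∷≢map-suc
listDiff-injectiveˡ {p = outside ∷ p} {outside ∷ q} {inside ∷ q′} _ _ eq = contradiction (sym eq) zero∷≢map-suc

listDiff-injectiveʳ : ∀ {n} {p p′ q : Subset n} → p ⊆ q → p′ ⊆ q → listDiff q p ≡ listDiff q p′ → p ≡ p′
listDiff-injectiveʳ {p = []} {[]} {[]} _ _ _ = refl
listDiff-injectiveʳ {p = inside ∷ p} {_} {outside ∷ q} p⊆q _ _ = contradiction (p⊆q here) λ ()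
listDiff-injectiveʳ {p = _} {inside ∷ p′} {outside ∷ q} _ p′⊆q _ = contradiction (p′⊆q here) λ ()
listDiff-injectiveʳ {p = outside ∷ p} {outside ∷ p′} {outside ∷ q} p⊆q p′⊆q eq =
  cong (outside ∷_) (listDiff-injectiveʳ (drop-∷-⊆ p⊆q) (drop-∷-⊆ p′⊆q) (map-suc-injective eq))
listDiff-injectiveʳ {p = inside ∷ p} {inside ∷ p′} {inside ∷ q} p⊆q p′⊆q eq =
  cong (inside ∷_) (listDiff-injectiveʳ (drop-∷-⊆ p⊆q) (drop-∷-⊆ p′⊆q) (map-suc-injective eq))
listDiff-injectiveʳ {p = outside ∷ p} {outside ∷ p′} {inside ∷ q} p⊆q p′⊆q eq =
  cong (outside ∷_) (listDiff-injectiveʳ (drop-∷-⊆ p⊆q) (drop-∷-⊆ p′⊆q) (map-suc-injective (proj₂ (∷-injective eq))))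
listDiff-injectiveʳ {p = inside ∷ p} {outside ∷ p′} {inside ∷ q} _ _ eq = contradiction (sym eq) zero∷≢map-suc
listDiff-injectiveʳ {p = outside ∷ p} {inside ∷ p′} {inside ∷ q} _ _ eq = contradiction eq zero∷≢map-suc

module _ (P : FinPoset) where
  open FinPoset P

  ∈-hasseEdges⁺ : ∀ {x y} → Covers P x y → (x , y) ∈ hasseEdges P
  ∈-hasseEdges⁺ {x} {y} =
    ∈-filter⁺ (λ e → covers? P (proj₁ e) (proj₂ e)) (∈-cartesianProduct⁺ (∈-allFin x) (∈-allFin y))

  ∈-hasseEdges⁻ : ∀ {e} → e ∈ hasseEdges P → Covers P (proj₁ e) (proj₂ e)
  ∈-hasseEdges⁻ =
    proj₂ ∘ ∈-filter⁻ (λ e → covers? P (proj₁ e) (proj₂ e)) {xs = cartesianProduct (allFin size) (allFin size)}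

  ∈-homs : ∀ {q} {v : Vec (Fin q) size} → IsHom P q (lookup v) → lookup v ∈ homs P q
  ∈-homs {q} {v} = ∈-filter⁺ (isHom? P q) (∈-map⁺ lookup (∈-allVecs v))

  module _ {n : ℕ} where

    Monotone : (Fin size → Subset n) → Set
    Monotone φ = ∀ {x y} → x <P y → φ x ⊆ φ y

    edgeWord : (Fin size → Subset n) → Fin size × Fin size → List (Fin n)
    edgeWord φ (x , y) = listDiff (φ y) (φ x)

    encode : Fin size → (Fin size → Subset n) → Subset n × List (List (Fin n))
    encode root φ = φ root , map (edgeWord φ) (hasseEdges P)

    encode-injective : Connected P → ∀ root {φ ψ} → Monotone φ → Monotone ψ →
                       encode root φ ≡ encode root ψ → φ ≗ ψ
    encode-injective connected root {φ} {ψ} φ-mono ψ-mono eq x = along (connected root x) (cong proj₁ eq)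
      where
      sameWord : ∀ {x y} → Covers P x y → edgeWord φ (x , y) ≡ edgeWord ψ (x , y)
      sameWord x⋖y = map-≡⇒≡ (cong proj₂ eq) (∈-hasseEdges⁺ x⋖y)

      up : ∀ {p p′ q q′ : Subset n} → p ≡ p′ → p ⊆ q → p′ ⊆ q′ →
           listDiff q p ≡ listDiff q′ p′ → q ≡ q′
      up refl = listDiff-injectiveˡ

      down : ∀ {p p′ q q′ : Subset n} → q ≡ q′ → p ⊆ q → p′ ⊆ q′ →
             listDiff q p ≡ listDiff q′ p′ → p ≡ p′
      down refl = listDiff-injectiveʳ

      along : ∀ {x z} → Walk P x z → φ x ≡ ψ x → φ z ≡ ψ z
      along (stop _) φx≡ψx = φx≡ψx
      along (step (inj₁ x⋖y) w) φx≡ψx =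
        along w (up φx≡ψx (φ-mono (proj₁ x⋖y)) (ψ-mono (proj₁ x⋖y)) (sameWord x⋖y))
      along (step (inj₂ y⋖x) w) φx≡ψx =
        along w (down φx≡ψx (φ-mono (proj₁ y⋖x)) (ψ-mono (proj₁ y⋖x)) (sameWord y⋖x))

record IsStrictMapIntoLevels (P : FinPoset) (n m q′ : ℕ) (φ : Fin (FinPoset.size P) → Subset n) : Set where
  open FinPoset P
  field
    strictlyMonotone : ∀ {x y} → x <P y → φ x ⊂ φ y
    above            : ∀ x → m ≤ ∣ φ x ∣
    below            : ∀ x → ∣ φ x ∣ ≤ m + q′

module Counting (P : FinPoset) (n m q′ : ℕ) (root : Fin (FinPoset.size P)) where
  open FinPoset P

  q top : ℕ
  q   = suc q′
  top = m + q′

  gap : (Fin size → Fin q) → Fin size × Fin size → ℕ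
  gap r (x , y) = ∣ toℕ (r x) - toℕ (r y) ∣

  weight : (Fin size → Fin q) → ℕ
  weight r = product (map (λ e → n ^ gap r e) (hasseEdges P))

  wordsAlong : (Fin size → Fin q) → List (List (List (Fin n)))
  wordsAlong r = map (words n ∘ gap r) (hasseEdges P)

  codesFor : (Fin size → Fin q) → List (Subset n × List (List (Fin n)))
  codesFor r = cartesianProduct (subsetsOfSize n (top ∸ toℕ (r root))) (choices (wordsAlong r))

  length-codesFor : ∀ r → length (codesFor r) ≤ weight r * (n C (n / 2))
  length-codesFor r = begin
    length (codesFor r)
      ≡⟨ length-cartesianProductWith _,_ (subsetsOfSize n k) (choices (wordsAlong r)) ⟩
    length (subsetsOfSize n k) * length (choices (wordsAlong r))
      ≡⟨ cong₂ _*_ (length-subsetsOfSize n k) (length-choices (wordsAlong r)) ⟩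
    (n C k) * product (map length (wordsAlong r))
      ≡⟨ cong (λ ls → (n C k) * product ls)
              (trans (sym (map-∘ (hasseEdges P))) (map-cong (length-words n ∘ gap r) (hasseEdges P))) ⟩
    (n C k) * weight r
      ≤⟨ *-monoˡ-≤ (weight r) (nCk≤nC[n/2] n k) ⟩
    (n C (n / 2)) * weight r
      ≡⟨ *-comm (n C (n / 2)) (weight r) ⟩
    weight r * (n C (n / 2)) ∎
    where
    open ≤-Reasoning
    k = top ∸ toℕ (r root)

  codes : List (Subset n × List (List (Fin n)))
  codes = concatMap codesFor (homs P q)

  length-codes : length codes ≤ bound P n q
  length-codes = length-concatMap-≤ codesFor weight (n C (n / 2)) length-codesFor (homs P q)

  module _ {φ : Fin size → Subset n} (φ-fits : IsStrictMapIntoLevels P n m q′ φ) where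
    open IsStrictMapIntoLevels φ-fits

    top∸∣φx∣≤q′ : ∀ x → top ∸ ∣ φ x ∣ ≤ q′
    top∸∣φx∣≤q′ x = ≤-trans (∸-monoʳ-≤ top (above x)) (≤-reflexive (m+n∸m≡n m q′))

    -- tabulated, so that rank has the form lookup v of the maps listed by homs
    rank : Fin size → Fin q
    rank = lookup (tabulate λ x → fromℕ< (s≤s (top∸∣φx∣≤q′ x)))

    toℕ-rank : ∀ x → toℕ (rank x) ≡ top ∸ ∣ φ x ∣
    toℕ-rank x = trans (cong toℕ (lookup∘tabulate _ x)) (toℕ-fromℕ< (s≤s (top∸∣φx∣≤q′ x)))

    rank-isHom : IsHom P q rank
    rank-isHom x y x<y = subst₂ _<_ (sym (toℕ-rank y)) (sym (toℕ-rank x))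
      (∸-monoʳ-< (p⊂q⇒∣p∣<∣q∣ (strictlyMonotone x<y)) (below y))

    rank∈homs : rank ∈ homs P q
    rank∈homs = ∈-homs P {v = tabulate _} rank-isHom

    length-edgeWord : ∀ {x y} → Covers P x y → length (edgeWord P φ (x , y)) ≡ gap rank (x , y)
    length-edgeWord {x} {y} x⋖y = begin
      length w                              ≡⟨ ∣m-m+n∣≡n ∣ φ x ∣ (length w) ⟨
      ∣ ∣ φ x ∣ - ∣ φ x ∣ + length w ∣      ≡⟨ cong (∣ ∣ φ x ∣ -_∣) (length-listDiff φx⊆φy) ⟩
      ∣ ∣ φ x ∣ - ∣ φ y ∣ ∣                 ≡⟨ ∣[m∸n]-[m∸o]∣≡∣n-o∣ (below x) (below y) ⟨
      ∣ (top ∸ ∣ φ x ∣) - (top ∸ ∣ φ y ∣) ∣ ≡⟨ cong₂ ∣_-_∣ (toℕ-rank x) (toℕ-rank y) ⟨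
      gap rank (x , y)                      ∎
      where
      open ≡-Reasoning
      w     = edgeWord P φ (x , y)
      φx⊆φy = proj₁ (strictlyMonotone (proj₁ x⋖y))

    encode∈codes : encode P root φ ∈ codes
    encode∈codes = ∈-concatMap⁺ codesFor (lose rank∈homs
      (∈-cartesianProduct⁺ (∈-subsetsOfSize (φ root) (sym root-level))
        (∈-choices⁺ (All.tabulate λ {e} e∈ →
          subst (λ d → edgeWord P φ e ∈ words n d) (length-edgeWord (∈-hasseEdges⁻ P e∈)) (∈-words _)))))
      where
      root-level : top ∸ toℕ (rank root) ≡ ∣ φ root ∣
      root-level = trans (cong (top ∸_) (toℕ-rank root)) (m∸[m∸n]≡n (below root))

length≤bound : ∀ (P : FinPoset) → Connected P → (root : Fin (FinPoset.size P)) → ∀ n m q′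
  → (maps : List (Fin (FinPoset.size P) → Subset n))
  → All (IsStrictMapIntoLevels P n m q′) maps
  → AllPairs (λ φ ψ → ¬ φ ≗ ψ) maps
  → length maps ≤ bound P n (suc q′)
length≤bound P connected root n m q′ maps fits distinct = begin
  length maps                       ≡⟨ length-map (encode P root) maps ⟨
  length (map (encode P root) maps) ≤⟨ Unique⇒length-≤ (Unique-map⁺ injective fits distinct)
                                                         (All.map⁺ (All.map encode∈codes fits)) ⟩
  length codes                      ≤⟨ length-codes ⟩
  bound P n (suc q′)                ∎
  where
  open Counting P n m q′ root
  open IsStrictMapIntoLevels
  open ≤-Reasoning
  injective : ∀ {φ ψ} → IsStrictMapIntoLevels P n m q′ φ → IsStrictMapIntoLevels P n m q′ ψ →
              encode P root φ ≡ encode P root ψ → φ ≗ ψ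
  injective φ-fits ψ-fits =
    encode-injective P connected root (proj₁ ∘ strictlyMonotone φ-fits) (proj₁ ∘ strictlyMonotone ψ-fits)

inducedCopy⇒strictMapIntoLevels : ∀ {P n q′ φ} → IsInducedCopy P n (suc q′) φ →
  IsStrictMapIntoLevels P n (middleStart n (suc q′)) q′ φ
inducedCopy⇒strictMapIntoLevels {P} {n} {q′} {φ} (_ , order , inMiddle) = record
  { strictlyMonotone = λ {x} {y} → Equivalence.to (order x y)
  ; above            = proj₁ ∘ inMiddle
  ; below            = λ x →
      m<1+n⇒m≤n (subst (∣ φ x ∣ <_) (+-suc (middleStart n (suc q′)) q′) (proj₂ (inMiddle x)))
  }

≗⇒SameImage : ∀ {k n} {φ ψ : Fin k → Subset n} → φ ≗ ψ → SameImage φ ψ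
≗⇒SameImage φ≗ψ = (λ x → x , φ≗ψ x) , (λ y → y , sym (φ≗ψ y))

lemma5p4 : (P : FinPoset) → IsTreePoset P → (q : ℕ) → 1 ≤ q → (n : ℕ)
           → (copies : List (Fin (FinPoset.size P) → Subset n))
           → All (IsInducedCopy P n q) copies
           → AllPairs (λ φ ψ → ¬ SameImage φ ψ) copies
           → length copies ≤ bound P n q
lemma5p4 P (1≤size , connected , _) (suc q′) _ n copies induced distinct =
  length≤bound P connected (fromℕ< 1≤size) n (middleStart n (suc q′)) q′ copies
    (All.map inducedCopy⇒strictMapIntoLevels induced)
    (AllPairs.map (λ ¬same → ¬same ∘ ≗⇒SameImage) distinct)
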